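{- Let $M = \prod_{p\mid M} p^{a_p}$ and $N = K \cdot \prod_{p\mid M} p^{b_p}$ be positive integers, with $M\ge 2$, $a_p, b_p \ge 1$ for every prime $p \mid M$, and $\gcd(K,M)=1$. Then the sequence $b(n) = \mathcal{B}_{M,N}(n) \bmod M$ ($n\ge 0$) is ultimately periodic, and, setting $\overline{t} := \max_{p\mid M} \lceil a_p / b_p \rceil$, its minimal period $P_{\min}$ satisfies $M \le P_{\min} \le M^{\overline{t}}$.
   Context: For integers $M\ge 2$, $N \ge 1$ and $n\ge 0$ with base-$M$ expansion $n=\sum_{i\ge 0} d_i(n) M^i$, $d_i(n)\in\{0,\dots,M-1\}$, the base-shifting map is $\mathcal{B}_{M,N}(n) := \sum_{i\ge 0} d_i(n) N^i$. The minimal period of an ultimately periodic sequence is the least $P>0$ such that $b(n+P)=b(n)$ for all sufficiently large $n$. -}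

module Defs where

open import Data.Nat using (ℕ; zero; suc; _+_; _*_; _∸_; _^_; _≤_; _<_; _/_; _%_)
open import Data.Nat.Divisibility using (_∣_)
open import Data.Nat.Primality using (Prime)
open import Data.Product using (Σ; _×_; ∃)
open import Relation.Nullary using (¬_)
open import Relation.Binary.PropositionalEquality using (_≡_)

-- digit-by-digit base shift with fuel: go f n = Σ_{i < f} d_i(n) N^i (base M digits)
shiftGo : (M N : ℕ) → ℕ → ℕ → ℕ
shiftGo zero    N f       n = 0            -- junk (M = 0 never used)
shiftGo (suc m) N zero    n = 0
shiftGo (suc m) N (suc f) n = n % suc m + N * shiftGo (suc m) N f (n / suc m)

-- B_{M,N}(n) = Σ_i d_i(n) N^i ; fuel n suffices since n has at most n base-M digits (M ≥ 2)
B : (M N n : ℕ) → ℕ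
B M N n = shiftGo M N n n

modN : ℕ → ℕ → ℕ
modN zero    x = x                          -- junk (M = 0 never used)
modN (suc m) x = x % suc m

bseq : (M N : ℕ) → ℕ → ℕ
bseq M N n = modN M (B M N n)

IsEventualPeriod : (ℕ → ℕ) → ℕ → Set
IsEventualPeriod s P = ∃ λ n₀ → ∀ n → n₀ ≤ n → s (n + P) ≡ s n

IsMinimalPeriod : (ℕ → ℕ) → ℕ → Set
IsMinimalPeriod s P =
  0 < P × IsEventualPeriod s P × (∀ Q → 0 < Q → Q < P → ¬ IsEventualPeriod s Q)

IsVal : ℕ → ℕ → ℕ → Set
IsVal p n v = (p ^ v) ∣ n × ¬ ((p ^ suc v) ∣ n)

ceilDiv : ℕ → ℕ → ℕ
ceilDiv a zero    = 0                       -- junk (b = 0 never used)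
ceilDiv a (suc k) = (a + k) / suc k

IsTbar : ℕ → ℕ → ℕ → Set
IsTbar M N t =
  (∀ p a b → Prime p → p ∣ M → IsVal p M a → IsVal p N b → ceilDiv a b ≤ t)
  × (∃ λ p → ∃ λ a → ∃ λ b → Prime p × p ∣ M × IsVal p M a × IsVal p N b × ceilDiv a b ≡ t)

-- Every prime p ∣ M has a_p ≤ t b_p, so M ∣ N ^ t. The digits of index ≥ t are therefore
-- multiplied by multiples of M, and for n ≥ t we get b(n) = g(n) with
-- g(n) = (Σ_{i<t} d_i(n) N^i) mod M, a function of n mod M ^ t. So M ^ t is an eventual period,
-- and the eventual periods of b are exactly the periods of g; being decidable, they have a
-- least positive element. Since t ≥ 1, g is the identity on [0, M), so a positive period
-- P < M of g would give P = g(P) = g(0) = 0.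
module Submission where

open import Defs
open import Data.Nat
  using (ℕ; zero; suc; _+_; _*_; _∸_; _^_; _≤_; _<_; NonZero; z<s
        ; >-nonZero; >-nonZero⁻¹; n>1⇒nonTrivial; nonTrivial⇒≢1; nonTrivial⇒n>1)
open import Data.Nat.Properties
open import Data.Nat.DivMod
open import Data.Nat.Divisibility
open import Data.Nat.Primality
open import Data.Nat.Primality.Factorisation using (factorise; PrimeFactorisation)
open import Data.Nat.Induction using (<-rec)
open import Data.Nat.ListAction using (product)
open import Data.List using ([]; _∷_)
open import Data.List.Relation.Unary.All using (All; []; _∷_)
open import Data.Product using (∃; _×_; _,_; proj₁)
open import Data.Sum using (inj₁; inj₂)
open import Data.Empty using (⊥-elim)
open import Function using (_∘_)
open import Relation.Nullary using (¬_; Dec; yes; no)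
open import Relation.Nullary.Decidable using (map′; _×-dec_)
open import Relation.Unary using (Decidable)
open import Relation.Binary.PropositionalEquality

module _ {P : ℕ → Set} (P? : Decidable P) where

  private
    LeastWitnessBelow : ℕ → Set
    LeastWitnessBelow n = ∃ λ r → r ≤ n × P r × (∀ {j} → j < r → ¬ P j)

  leastWitness : ∀ n → P n → LeastWitnessBelow n
  leastWitness = <-rec _ step
    where
    step : ∀ n → (∀ {m} → m < n → P m → LeastWitnessBelow m) → P n → LeastWitnessBelow n
    step n rec pn with anyUpTo? P? n
    ... | no none = n , ≤-refl , pn , λ j<n pj → none (_ , j<n , pj)
    ... | yes (j , j<n , pj) with rec j<n pj
    ...   | r , r≤j , pr , below = r , ≤-trans r≤j (<⇒≤ j<n) , pr , below

Periodic : (ℕ → ℕ) → ℕ → Set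
Periodic g Q = ∀ n → g (n + Q) ≡ g n

identityBelow⇒period≥ : ∀ {g M P} → (∀ {n} → n < M → g n ≡ n) → Periodic g P → 0 < P → M ≤ P
identityBelow⇒period≥ {g} {M} {P} id<M periodic P>0 with M ≤? P
... | yes M≤P = M≤P
... | no M≰P = ⊥-elim (<-irrefl (sym P≡0) P>0)
  where
  P<M : P < M
  P<M = ≰⇒> M≰P

  P≡0 : P ≡ 0
  P≡0 = begin
    P     ≡⟨ id<M P<M ⟨
    g P   ≡⟨ periodic 0 ⟩
    g 0   ≡⟨ id<M (<-trans P>0 P<M) ⟩
    0     ∎
    where open ≡-Reasoning

module EventuallyPeriodic {s g : ℕ → ℕ} (T n₀ : ℕ) .{{_ : NonZero T}}
  (g-mod : ∀ n → g n ≡ g (n % T)) (s≡g : ∀ {n} → n₀ ≤ n → s n ≡ g n) where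

  open ≡-Reasoning

  g-cong : ∀ {m n} → m % T ≡ n % T → g m ≡ g n
  g-cong {m} {n} eq = trans (g-mod m) (trans (cong g eq) (sym (g-mod n)))

  g-*+ : ∀ k n → g (k * T + n) ≡ g n
  g-*+ k n = g-cong (%-remove-+ˡ n (n∣m*n k))

  periodic-T : Periodic g T
  periodic-T n = g-cong ([m+n]%n≡m%n n T)

  periodic⇒eventualPeriod : ∀ {Q} → Periodic g Q → IsEventualPeriod s Q
  periodic⇒eventualPeriod {Q} periodic = n₀ , λ n n₀≤n → begin
    s (n + Q)  ≡⟨ s≡g (≤-trans n₀≤n (m≤m+n n Q)) ⟩
    g (n + Q)  ≡⟨ periodic n ⟩
    g n        ≡⟨ s≡g n₀≤n ⟨
    s n        ∎

  eventualPeriod⇒periodic : ∀ {Q} → IsEventualPeriod s Q → Periodic g Q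
  eventualPeriod⇒periodic {Q} (n₁ , eventually) n = begin
    g (n + Q)            ≡⟨ g-*+ K (n + Q) ⟨
    g (K * T + (n + Q))  ≡⟨ cong g (+-assoc (K * T) n Q) ⟨
    g (x + Q)            ≡⟨ s≡g (≤-trans n₀≤x (m≤m+n x Q)) ⟨
    s (x + Q)            ≡⟨ eventually x n₁≤x ⟩
    s x                  ≡⟨ s≡g n₀≤x ⟩
    g x                  ≡⟨ g-*+ K n ⟩
    g n                  ∎
    where
    K = n₁ + n₀
    x = K * T + n
    K≤x : K ≤ x
    K≤x = ≤-trans (m≤m*n K T) (m≤m+n (K * T) n)
    n₁≤x : n₁ ≤ x
    n₁≤x = ≤-trans (m≤m+n n₁ n₀) K≤x
    n₀≤x : n₀ ≤ x
    n₀≤x = ≤-trans (m≤n+m n₀ n₁) K≤x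

  periodicBelow⇒periodic : ∀ {Q} → (∀ {n} → n < T → g (n + Q) ≡ g n) → Periodic g Q
  periodicBelow⇒periodic {Q} periodicBelow n = begin
    g (n + Q)      ≡⟨ g-cong reduce ⟩
    g (n % T + Q)  ≡⟨ periodicBelow (m%n<n n T) ⟩
    g (n % T)      ≡⟨ g-mod n ⟨
    g n            ∎
    where
    reduce : (n + Q) % T ≡ (n % T + Q) % T
    reduce = begin
      (n + Q) % T                ≡⟨ %-distribˡ-+ n Q T ⟩
      (n % T + Q % T) % T        ≡⟨ cong (λ r → (r + Q % T) % T) (m%n%n≡m%n n T) ⟨
      (n % T % T + Q % T) % T    ≡⟨ %-distribˡ-+ (n % T) Q T ⟨
      (n % T + Q) % T            ∎

  periodic? : ∀ Q → Dec (Periodic g Q)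
  periodic? Q = map′ periodicBelow⇒periodic (λ periodic {n} _ → periodic n)
                     (allUpTo? (λ n → g (n + Q) ≟ g n) T)

  minimalPeriod : ∃ λ P → IsMinimalPeriod s P × P ≤ T × Periodic g P
  minimalPeriod with leastWitness (λ Q → (0 <? Q) ×-dec periodic? Q) T (>-nonZero⁻¹ T , periodic-T)
  ... | P , P≤T , (P>0 , periodic) , below =
    P , (P>0 , periodic⇒eventualPeriod periodic , notBelow) , P≤T , periodic
    where
    notBelow : ∀ Q → 0 < Q → Q < P → ¬ IsEventualPeriod s Q
    notBelow Q Q>0 Q<P ev = below Q<P (Q>0 , eventualPeriod⇒periodic ev)

module BaseShift (m N : ℕ) where

  M : ℕ
  M = suc m

  open ≡-Reasoning

  shiftGo-zero : ∀ k → shiftGo M N k 0 ≡ 0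
  shiftGo-zero zero    = refl
  shiftGo-zero (suc k) = trans (cong (N *_) (shiftGo-zero k)) (*-zeroʳ N)

  shiftGo-+ : ∀ k f n → ∃ λ y → shiftGo M N (k + f) n ≡ shiftGo M N k n + N ^ k * y
  shiftGo-+ zero    f n = shiftGo M N f n , sym (+-identityʳ _)
  shiftGo-+ (suc k) f n with shiftGo-+ k f (n / M)
  ... | y , eq = y , (begin
    n % M + N * shiftGo M N (k + f) (n / M)          ≡⟨ cong (λ r → n % M + N * r) eq ⟩
    n % M + N * (shiftGo M N k (n / M) + N ^ k * y)  ≡⟨ cong (n % M +_) (*-distribˡ-+ N _ _) ⟩
    n % M + (N * shiftGo M N k (n / M) + N * (N ^ k * y))
      ≡⟨ +-assoc (n % M) _ _ ⟨
    n % M + N * shiftGo M N k (n / M) + N * (N ^ k * y)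
      ≡⟨ cong (n % M + N * shiftGo M N k (n / M) +_) (*-assoc N (N ^ k) y) ⟨
    n % M + N * shiftGo M N k (n / M) + N ^ suc k * y  ∎)

  shiftGo-% : ∀ k n .{{_ : NonZero (M ^ k)}} → shiftGo M N k n ≡ shiftGo M N k (n % M ^ k)
  shiftGo-% zero    n = refl
  shiftGo-% (suc k) n =
    cong₂ (λ d r → d + N * r) lowestDigit (trans (shiftGo-% k (n / M)) (cong (shiftGo M N k) higherDigits))
    where
    instance
      M^k≢0 : NonZero (M ^ k)
      M^k≢0 = m^n≢0 M k
      M^k*M≢0 : NonZero (M ^ k * M)
      M^k*M≢0 = m*n≢0 (M ^ k) M

    lowestDigit : n % M ≡ n % M ^ suc k % M
    lowestDigit = sym (m∣n⇒o%n%m≡o%m M (M ^ suc k) n (m∣m*n (M ^ k)))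

    higherDigits : n / M % M ^ k ≡ n % M ^ suc k / M
    higherDigits = sym (trans (/-congˡ (%-congʳ (*-comm M (M ^ k)))) (m%[n*o]/o≡m/o%n n (M ^ k) M))

  shiftGo-digit : ∀ {k} → 0 < k → ∀ {n} → n < M → shiftGo M N k n % M ≡ n
  shiftGo-digit {suc k} _ {n} n<M = begin
    (n % M + N * shiftGo M N k (n / M)) % M
      ≡⟨ cong (λ q → (n % M + N * shiftGo M N k q) % M) (m<n⇒m/n≡0 n<M) ⟩
    (n % M + N * shiftGo M N k 0) % M        ≡⟨ %-remove-+ʳ (n % M) M∣N*0 ⟩
    n % M % M                                ≡⟨ m%n%n≡m%n n M ⟩
    n % M                                    ≡⟨ m<n⇒m%n≡m n<M ⟩
    n                                        ∎
    where
    M∣N*0 : M ∣ N * shiftGo M N k 0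
    M∣N*0 = subst (M ∣_) (sym (trans (cong (N *_) (shiftGo-zero k)) (*-zeroʳ N))) (M ∣0)

  -- Digits of index ≥ t are multiplied by N ^ t, which vanishes mod M.
  bseq≡shiftGo : ∀ {t n} → M ∣ N ^ t → t ≤ n → bseq M N n ≡ shiftGo M N t n % M
  bseq≡shiftGo {t} {n} M∣N^t t≤n with shiftGo-+ t (n ∸ t) n
  ... | y , eq = begin
    shiftGo M N n n % M                  ≡⟨ cong (λ f → shiftGo M N f n % M) (m+[n∸m]≡n t≤n) ⟨
    shiftGo M N (t + (n ∸ t)) n % M      ≡⟨ %-congˡ eq ⟩
    (shiftGo M N t n + N ^ t * y) % M    ≡⟨ %-remove-+ʳ (shiftGo M N t n) (∣m⇒∣m*n y M∣N^t) ⟩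
    shiftGo M N t n % M                  ∎

^-monoʳ-∣ : ∀ m {i j} → i ≤ j → m ^ i ∣ m ^ j
^-monoʳ-∣ m {i} {j} i≤j = divides (m ^ (j ∸ i)) (begin
  m ^ j                ≡⟨ cong (m ^_) (m+[n∸m]≡n i≤j) ⟨
  m ^ (i + (j ∸ i))    ≡⟨ ^-distribˡ-+-* m i (j ∸ i) ⟩
  m ^ i * m ^ (j ∸ i)  ≡⟨ *-comm (m ^ i) _ ⟩
  m ^ (j ∸ i) * m ^ i  ∎)
  where open ≡-Reasoning

^-monoˡ-∣ : ∀ k {m n} → m ∣ n → m ^ k ∣ n ^ k
^-monoˡ-∣ zero    m∣n = 1∣ 1
^-monoˡ-∣ (suc k) m∣n = *-pres-∣ m∣n (^-monoˡ-∣ k m∣n)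

IsVal-* : ∀ {p n v} .{{_ : NonZero p}} → IsVal p n v → IsVal p (p * n) (suc v)
IsVal-* {p} (p^v∣n , p^1+v∤n) = *-monoʳ-∣ p p^v∣n , p^1+v∤n ∘ *-cancelˡ-∣ p

valuation : ∀ {p} → 1 < p → ∀ n → 0 < n → ∃ (IsVal p n)
valuation {p} 1<p = <-rec (λ n → 0 < n → ∃ (IsVal p n)) step
  where
  instance
    p≢0 : NonZero p
    p≢0 = >-nonZero (<-trans z<s 1<p)

  step : ∀ n → (∀ {m} → m < n → 0 < m → ∃ (IsVal p m)) → 0 < n → ∃ (IsVal p n)
  step n rec n>0 with p ∣? n
  ... | no p∤n = 0 , 1∣ n , p∤n ∘ subst (_∣ n) (*-identityʳ p)
  ... | yes p∣n = let v , q-val = rec q<n q>0 in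
    suc v , subst (λ m → IsVal p m (suc v)) (sym (m∣n⇒n≡m*quotient p∣n)) (IsVal-* {v = v} q-val)
    where
    instance
      n≢0 : NonZero n
      n≢0 = >-nonZero n>0
    q<n : quotient p∣n < n
    q<n = quotient-< p∣n {{n>1⇒nonTrivial 1<p}}
    q>0 : 0 < quotient p∣n
    q>0 = >-nonZero⁻¹ _ {{quotient≢0 p∣n}}

IsVal⇒^∣⇒≤ : ∀ {p n v k} → IsVal p n v → p ^ k ∣ n → k ≤ v
IsVal⇒^∣⇒≤ {p} {v = v} {k} (_ , p^1+v∤n) p^k∣n with k ≤? v
... | yes k≤v = k≤v
... | no k≰v = ⊥-elim (p^1+v∤n (∣-trans (^-monoʳ-∣ p (≰⇒> k≰v)) p^k∣n))

ceilDiv≤⇒≤* : ∀ a b {t} → ceilDiv a (suc b) ≤ t → a ≤ suc b * t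
ceilDiv≤⇒≤* a b {t} ⌈a/b⌉≤t = +-cancelʳ-≤ b a (suc b * t) (begin
  a + b                                        ≡⟨ m≡m%n+[m/n]*n (a + b) (suc b) ⟩
  (a + b) % suc b + (a + b) / suc b * suc b    ≤⟨ +-mono-≤ (m<1+n⇒m≤n (m%n<n (a + b) (suc b)))
                                                           (*-monoˡ-≤ (suc b) ⌈a/b⌉≤t) ⟩
  b + t * suc b                                ≡⟨ cong (b +_) (*-comm t (suc b)) ⟩
  b + suc b * t                                ≡⟨ +-comm b _ ⟩
  suc b * t + b                                ∎)
  where open ≤-Reasoning

q^k∣p*n⇒q^k∣n : ∀ {p q} → Prime p → Prime q → q ≢ p → ∀ k n → q ^ k ∣ p * n → q ^ k ∣ n
q^k∣p*n⇒q^k∣n pp qq q≢p zero n _ = 1∣ n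
q^k∣p*n⇒q^k∣n {p} {q} pp qq q≢p (suc k) n q^1+k∣p*n
  with euclidsLemma p n qq (m*n∣⇒m∣ q (q ^ k) q^1+k∣p*n)
... | inj₁ q∣p with prime⇒irreducible pp q∣p
...   | inj₁ q≡1 = ⊥-elim (nonTrivial⇒≢1 {{prime⇒nonTrivial qq}} q≡1)
...   | inj₂ q≡p = ⊥-elim (q≢p q≡p)
q^k∣p*n⇒q^k∣n {p} {q} pp qq q≢p (suc k) n q^1+k∣p*n | inj₂ q∣n =
  subst (q ^ suc k ∣_) (sym n≡q*n′) (*-monoʳ-∣ q q^k∣n′)
  where
  instance
    q≢0 : NonZero q
    q≢0 = prime⇒nonZero qq
  n′ = quotient q∣n
  n≡q*n′ : n ≡ q * n′
  n≡q*n′ = m∣n⇒n≡m*quotient q∣n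
  p*n≡q*[p*n′] : p * n ≡ q * (p * n′)
  p*n≡q*[p*n′] = begin
    p * n         ≡⟨ cong (p *_) n≡q*n′ ⟩
    p * (q * n′)  ≡⟨ *-assoc p q n′ ⟨
    p * q * n′    ≡⟨ cong (_* n′) (*-comm p q) ⟩
    q * p * n′    ≡⟨ *-assoc q p n′ ⟩
    q * (p * n′)  ∎
    where open ≡-Reasoning
  q^k∣n′ : q ^ k ∣ n′
  q^k∣n′ = q^k∣p*n⇒q^k∣n pp qq q≢p k n′
             (*-cancelˡ-∣ q (subst (q ^ suc k ∣_) p*n≡q*[p*n′] q^1+k∣p*n))

product∣ : ∀ {ps x} → All Prime ps → (∀ p k → Prime p → p ^ k ∣ product ps → p ^ k ∣ x) → product ps ∣ x
product∣ {[]}     {x} _ _ = 1∣ x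
product∣ {p ∷ ps} {x} (pp ∷ psPrime) powers∣x =
  subst (p * product ps ∣_) (sym x≡p*y) (*-monoʳ-∣ p (product∣ psPrime powers∣y))
  where
  instance
    p≢0 : NonZero p
    p≢0 = prime⇒nonZero pp
  p∣x : p ∣ x
  p∣x = subst (_∣ x) (*-identityʳ p)
          (powers∣x p 1 pp (subst (_∣ p * product ps) (sym (*-identityʳ p)) (m∣m*n (product ps))))
  y = quotient p∣x
  x≡p*y : x ≡ p * y
  x≡p*y = m∣n⇒n≡m*quotient p∣x
  powers∣y : ∀ q k → Prime q → q ^ k ∣ product ps → q ^ k ∣ y
  powers∣y q k qq q^k∣ps with q ≟ p
  ... | yes refl =
    *-cancelˡ-∣ q (subst (q ^ suc k ∣_) x≡p*y (powers∣x q (suc k) qq (*-monoʳ-∣ q q^k∣ps)))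
  ... | no q≢p =
    q^k∣p*n⇒q^k∣n pp qq q≢p k y (subst (q ^ k ∣_) x≡p*y (powers∣x q k qq (∣n⇒∣m*n p q^k∣ps)))

primePowers∣⇒∣ : ∀ {n x} .{{_ : NonZero n}} → (∀ p k → Prime p → p ^ k ∣ n → p ^ k ∣ x) → n ∣ x
primePowers∣⇒∣ {n} {x} powers∣x = subst (_∣ x) (sym isFactorisation) (product∣ factorsPrime powers∣x′)
  where
  open PrimeFactorisation (factorise n)
  powers∣x′ : ∀ p k → Prime p → p ^ k ∣ product factors → p ^ k ∣ x
  powers∣x′ p k pp = powers∣x p k pp ∘ subst (_ ∣_) (sym isFactorisation)

IsTbar⇒∣^ : ∀ {M N t} → 0 < M → 0 < N → (∀ p → Prime p → p ∣ M → p ∣ N) → IsTbar M N t → M ∣ N ^ t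
IsTbar⇒∣^ {M} {N} {t} M>0 N>0 primes∣N (⌈a/b⌉≤t , _) = primePowers∣⇒∣ {{>-nonZero M>0}} p^k∣N^t
  where
  p^k∣N^t : ∀ p k → Prime p → p ^ k ∣ M → p ^ k ∣ N ^ t
  p^k∣N^t p zero    _  _      = 1∣ (N ^ t)
  p^k∣N^t p (suc k) pp p^k∣M = bound (valuation 1<p M M>0) (valuation 1<p N N>0)
    where
    1<p = nonTrivial⇒n>1 p {{prime⇒nonTrivial pp}}
    p∣M = m*n∣⇒m∣ p (p ^ k) p^k∣M
    bound : ∃ (IsVal p M) → ∃ (IsVal p N) → p ^ suc k ∣ N ^ t
    bound _ (zero , _ , p∤N) = ⊥-elim (p∤N (subst (_∣ N) (sym (*-identityʳ p)) (primes∣N p pp p∣M)))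
    bound (a , valM) (suc b , valN) = ∣-trans (^-monoʳ-∣ p k≤[1+b]t) p^[1+b]t∣N^t
      where
      k≤[1+b]t : suc k ≤ suc b * t
      k≤[1+b]t = ≤-trans (IsVal⇒^∣⇒≤ {v = a} valM p^k∣M)
                         (ceilDiv≤⇒≤* a b (⌈a/b⌉≤t p a (suc b) pp p∣M valM valN))
      p^[1+b]t∣N^t : p ^ (suc b * t) ∣ N ^ t
      p^[1+b]t∣N^t = subst (_∣ N ^ t) (^-*-assoc p (suc b) t) (^-monoˡ-∣ t (proj₁ valN))

∣^⇒exponent>0 : ∀ {d n t} → 1 < d → d ∣ n ^ t → 0 < t
∣^⇒exponent>0 {t = zero}  1<d d∣1 = ⊥-elim (<-irrefl (sym (∣1⇒≡1 d∣1)) 1<d)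
∣^⇒exponent>0 {t = suc t} _   _   = z<s

proposition2p3 : (M N : ℕ) → 2 ≤ M → 1 ≤ N
    → (∀ p → Prime p → p ∣ M → p ∣ N)
    → (t : ℕ) → IsTbar M N t
    → ∃ λ P → IsMinimalPeriod (bseq M N) P × M ≤ P × P ≤ M ^ t
proposition2p3 (suc m) N M≥2 N≥1 primes∣N t tbar =
  let P , minimal , P≤M^t , periodic = minimalPeriod
  in  P , minimal , identityBelow⇒period≥ (shiftGo-digit t>0) periodic (proj₁ minimal) , P≤M^t
  where
  open BaseShift m N

  M∣N^t : M ∣ N ^ t
  M∣N^t = IsTbar⇒∣^ z<s N≥1 primes∣N tbar

  t>0 : 0 < t
  t>0 = ∣^⇒exponent>0 M≥2 M∣N^t

  instance
    M^t≢0 : NonZero (M ^ t)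
    M^t≢0 = m^n≢0 M t

  open EventuallyPeriodic {bseq M N} {λ n → shiftGo M N t n % M} (M ^ t) t
         (λ n → cong (_% M) (shiftGo-% t n)) (bseq≡shiftGo M∣N^t)
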